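{- For every kind assignment $K$, monotype $\tau$, label $l$ and monotype $\tau'$: (1) if $K\Vdash\tau::\{\!\{l:\tau',\dots\,\|\,\dots\}\!\}$, then $K\not\Vdash\tau::\{\!\{\dots\,\|\,l:\tau',\dots\}\!\}$; (2) if $K\Vdash\tau::\{\!\{\dots\,\|\,l:\tau',\dots\}\!\}$, then $K\not\Vdash\tau::\{\!\{l:\tau',\dots\,\|\,\dots\}\!\}$. (Here "$\dots$" stands for arbitrary further fields.)
   Context: Types. Fix type variables $\alpha,\dots$, labels $l,\dots$ and finitely many base types $b$. $\tau ::= b\mid\rho\mid\tau\to\tau$; $\rho ::= \alpha\mid\{l_1:\tau_1,\dots,l_n:\tau_n\}\mid\rho+\{l:\tau\}\mid\rho-\{l:\tau\}$ (record types, type extensions, type contractions); kinds $k ::= \mathcal{U}\mid\{\!\{l_1:\tau_1,\dots,l_n:\tau_n\,\|\,l'_1:\tau'_1,\dots,l'_m:\tau'_m\}\!\}$ (universal kind; record kind whose left fields must be present and right fields absent). Labels within a record type or kind are pairwise distinct and unordered. A kind assignment $K$ is a finite map from type variables to kinds with $\mathrm{FTV}(K(\alpha))\subseteq\mathrm{dom}K$ for all $\alpha\in\mathrm{dom}K$; an object is well formed under $K$ if its free type variables lie in $\mathrm{dom}K$. Kinding. $K\Vdash\tau::k$ iff derivable by: (i) $K\Vdash\tau::\mathcal{U}$ for $\tau$ well formed under $K$; (ii) $K\Vdash\{l_1:\tau_1,\dots,l_n:\tau_n,\dots\}::\{\!\{l_1:\tau_1,\dots,l_n:\tau_n\,\|\,l'_1:\tau'_1,\dots,l'_m:\tau'_m\}\!\}$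 if $\{l_1,\dots,l_n,\dots\}\cap\{l'_1,\dots,l'_m\}=\emptyset$ and the record type and the $\tau'_i$ are well formed under $K$; (iii) $K\Vdash\alpha::\{\!\{F^l\|F^r\}\!\}$ if $K(\alpha)=\{\!\{F^l,\dots\|F^r,\dots\}\!\}$; (iv) $K\Vdash\rho+\{l:\tau\}::\{\!\{F^l,[l:\tau]\|F^r\}\!\}$ if $K\Vdash\rho::\{\!\{F^l\|F^r,l:\tau\}\!\}$; (v) $K\Vdash\rho-\{l:\tau\}::\{\!\{F^l\|F^r,[l:\tau]\}\!\}$ if $K\Vdash\rho::\{\!\{F^l,l:\tau\|F^r\}\!\}$; $F^l,F^r$ are lists of fields and $[l:\tau]$ denotes optional inclusion. -}

module Defs where

open import Data.Nat using (ℕ; _<_)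
open import Data.Fin using (Fin)
open import Data.Bool using (Bool; true; false)
open import Data.List using (List; []; _∷_; _++_; map)
open import Data.Product using (_×_; _,_; proj₁)
open import Data.Sum using (_⊎_)
open import Data.Unit using (⊤)
open import Data.Empty using (⊥)
open import Relation.Binary.PropositionalEquality using (_≡_)
open import Data.List.Membership.Propositional using (_∈_; _∉_)
open import Data.List.Relation.Binary.Subset.Propositional using (_⊆_)
open import Data.List.Relation.Binary.Permutation.Propositional using (_↭_)
open import Data.List.Relation.Unary.Unique.Propositional using (Unique)

Label : Set
Label = ℕ

TyVar : Set
TyVar = ℕ

-- Record types {l₁:τ₁,…,lₙ:τₙ} are unordered with distinct labels; we
-- represent them canonically by lists with strictly increasing labels
-- (enforced intrinsically), so that syntactic equality of types coincides
-- with equality of types up to reordering of record fields.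
data Ty (B : ℕ) : Set
data Row (B : ℕ) : Set
data Fields (B : ℕ) : Set
_<ᴴ_ : {B : ℕ} → Label → Fields B → Set

data Ty B where
  base : Fin B → Ty B
  row  : Row B → Ty B
  _⇒_  : Ty B → Ty B → Ty B

data Row B where
  tvar : TyVar → Row B
  recd : Fields B → Row B
  _⊕_  : Row B → Label × Ty B → Row B
  _⊖_  : Row B → Label × Ty B → Row B

data Fields B where
  fnil  : Fields B
  fcons : (l : Label) (τ : Ty B) (fs : Fields B) → l <ᴴ fs → Fields B

l <ᴴ fnil = ⊤
l <ᴴ fcons l' _ _ _ = l < l'

Field : ℕ → Set
Field B = Label × Ty B

_∈ᶠ_ : {B : ℕ} → Field B → Fields B → Set
f ∈ᶠ fnil = ⊥
f ∈ᶠ fcons l τ fs _ = f ≡ (l , τ) ⊎ f ∈ᶠ fs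

labelsᶠ : {B : ℕ} → Fields B → List Label
labelsᶠ fnil = []
labelsᶠ (fcons l _ fs _) = l ∷ labelsᶠ fs

ftvTy : {B : ℕ} → Ty B → List TyVar
ftvRow : {B : ℕ} → Row B → List TyVar
ftvFields : {B : ℕ} → Fields B → List TyVar

ftvTy (base _) = []
ftvTy (row ρ) = ftvRow ρ
ftvTy (σ ⇒ τ) = ftvTy σ ++ ftvTy τ

ftvRow (tvar α) = α ∷ []
ftvRow (recd fs) = ftvFields fs
ftvRow (ρ ⊕ (_ , τ)) = ftvRow ρ ++ ftvTy τ
ftvRow (ρ ⊖ (_ , τ)) = ftvRow ρ ++ ftvTy τ

ftvFields fnil = []
ftvFields (fcons _ τ fs _) = ftvTy τ ++ ftvFields fs

ftvFieldList : {B : ℕ} → List (Field B) → List TyVar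
ftvFieldList [] = []
ftvFieldList ((_ , τ) ∷ fs) = ftvTy τ ++ ftvFieldList fs

-- Kinds: the universal kind 𝒰 and record kinds {{ F^l ∥ F^r }}.
-- Fields of a kind are unordered (lists read up to permutation / as sets).
data Kind (B : ℕ) : Set where
  𝒰     : Kind B
  ⟦_∥_⟧ : List (Field B) → List (Field B) → Kind B

DistinctKind : {B : ℕ} → List (Field B) → List (Field B) → Set
DistinctKind Fl Fr = Unique (map proj₁ (Fl ++ Fr))

IsKind : {B : ℕ} → Kind B → Set
IsKind 𝒰 = ⊤
IsKind ⟦ Fl ∥ Fr ⟧ = DistinctKind Fl Fr

ftvKind : {B : ℕ} → Kind B → List TyVar
ftvKind 𝒰 = []
ftvKind ⟦ Fl ∥ Fr ⟧ = ftvFieldList Fl ++ ftvFieldList Fr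

KAssign : ℕ → Set
KAssign B = List (TyVar × Kind B)

dom : {B : ℕ} → KAssign B → List TyVar
dom K = map proj₁ K

WfKAssign : {B : ℕ} → KAssign B → Set
WfKAssign K =
  Unique (dom K) ×
  (∀ {α k} → (α , k) ∈ K → IsKind k × ftvKind k ⊆ dom K)

WfTy : {B : ℕ} → KAssign B → Ty B → Set
WfTy K τ = ftvTy τ ⊆ dom K

opt : {B : ℕ} → Bool → Field B → List (Field B) → List (Field B)
opt true f F = f ∷ F
opt false f F = F

-- The kinding relation K ⊩ τ ∷ k (rules (i)–(v)); kinds are read up to
-- reordering of their fields, and every concluded kind must be a kind.
data _⊩_∷_ {B : ℕ} (K : KAssign B) : Ty B → Kind B → Set where
  kU   : {τ : Ty B} → WfTy K τ → K ⊩ τ ∷ 𝒰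
  kRec : {fs : Fields B} {Fl Fr : List (Field B)} →
         DistinctKind Fl Fr →
         (∀ {f} → f ∈ Fl → f ∈ᶠ fs) →
         (∀ {l} → l ∈ labelsᶠ fs → l ∉ map proj₁ Fr) →
         WfTy K (row (recd fs)) →
         (∀ {f} → f ∈ Fr → WfTy K (Data.Product.proj₂ f)) →
         K ⊩ row (recd fs) ∷ ⟦ Fl ∥ Fr ⟧
  kVar : {α : TyVar} {Gl Gr Fl Fr : List (Field B)} →
         DistinctKind Fl Fr →
         (α , ⟦ Gl ∥ Gr ⟧) ∈ K →
         Fl ⊆ Gl → Fr ⊆ Gr →
         K ⊩ row (tvar α) ∷ ⟦ Fl ∥ Fr ⟧
  kExt : {ρ : Row B} {f : Field B} {Fl Fr Gl Gr : List (Field B)}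
         (b : Bool) →
         DistinctKind Gl Gr →
         K ⊩ row ρ ∷ ⟦ Fl ∥ Fr ⟧ →
         Gl ↭ opt b f Fl → Fr ↭ f ∷ Gr →
         K ⊩ row (ρ ⊕ f) ∷ ⟦ Gl ∥ Gr ⟧
  kCon : {ρ : Row B} {f : Field B} {Fl Fr Gl Gr : List (Field B)}
         (b : Bool) →
         DistinctKind Gl Gr →
         K ⊩ row ρ ∷ ⟦ Fl ∥ Fr ⟧ →
         Fl ↭ f ∷ Gl → Gr ↭ opt b f Fr →
         K ⊩ row (ρ ⊖ f) ∷ ⟦ Gl ∥ Gr ⟧

{-# OPTIONS --safe #-}
-- Kinding is syntax-directed on record types, so two kindings of the same type
-- end in the same rule and can be compared by simultaneous induction.  A field
-- demanded present by one and absent by the other is impossible at a record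
-- type by rule (ii), and at a type variable because K assigns it a single
-- kind with distinct labels.  For ρ ± {l:τ} the field either comes from the
-- kinding of ρ (induction) or is the extended/contracted field itself, whose
-- label would then occur twice in a kind.
module Submission where

open import Defs
open import Data.Nat using (ℕ)
open import Data.List using (List; []; _∷_; _++_; map)
open import Data.List.Properties using (map-++)
open import Data.Product using (_×_; _,_; proj₁; proj₂)
open import Data.Sum using (_⊎_; inj₁; inj₂)
open import Data.Bool using (true; false)
open import Data.Empty using (⊥-elim)
open import Function using (_∘_)
open import Relation.Nullary using (¬_)
open import Relation.Binary.PropositionalEquality using (_≡_; refl; subst)
open import Relation.Binary.PropositionalEquality.Properties using (setoid)
open import Data.List.Membership.Propositional using (_∈_; _∉_)
open import Data.List.Membership.Propositional.Properties using (∈-map⁺; ∈-++⁺ʳ)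
open import Data.List.Relation.Unary.Any using (here; there)
import Data.List.Relation.Unary.All as All
open import Data.List.Relation.Unary.All.Properties using (++⁻ˡ)
open import Data.List.Relation.Unary.AllPairs using ([]; _∷_)
open import Data.List.Relation.Unary.Unique.Propositional using (Unique)
open import Data.List.Relation.Binary.Disjoint.Propositional using (Disjoint)
open import Data.List.Relation.Binary.Permutation.Propositional using (_↭_; ↭-sym; ↭⇒↭ₛ)
open import Data.List.Relation.Binary.Permutation.Propositional.Properties
  using (∈-resp-↭; map⁺)
open import Data.List.Relation.Binary.Permutation.Setoid.Properties using (Unique-resp-↭)

module _ {a} {A : Set a} where

  Unique-++⁻ˡ : ∀ xs {ys : List A} → Unique (xs ++ ys) → Unique xs
  Unique-++⁻ˡ []       _        = []
  Unique-++⁻ˡ (_ ∷ xs) (x∉ ∷ u) = ++⁻ˡ xs x∉ ∷ Unique-++⁻ˡ xs u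

  Unique-++⁻ʳ : ∀ xs {ys : List A} → Unique (xs ++ ys) → Unique ys
  Unique-++⁻ʳ []       u       = u
  Unique-++⁻ʳ (_ ∷ xs) (_ ∷ u) = Unique-++⁻ʳ xs u

  Unique-++⇒Disjoint : ∀ xs {ys : List A} → Unique (xs ++ ys) → Disjoint xs ys
  Unique-++⇒Disjoint (_ ∷ xs) (x∉ ∷ _) (here refl , v∈ys) = All.lookup x∉ (∈-++⁺ʳ xs v∈ys) refl
  Unique-++⇒Disjoint (_ ∷ xs) (_ ∷ u)  (there v∈xs , v∈ys) = Unique-++⇒Disjoint xs u (v∈xs , v∈ys)

  Unique-↭-∷⇒∉ : ∀ {xs ys : List A} {x} → Unique xs → xs ↭ x ∷ ys → x ∉ ys
  Unique-↭-∷⇒∉ u p x∈ys with Unique-resp-↭ (setoid A) (↭⇒↭ₛ p) u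
  ... | x∉ ∷ _ = All.lookup x∉ x∈ys refl

module _ {a b} {A : Set a} {V : Set b} where

  Unique-keys⇒functional : ∀ {xs : List (A × V)} {k v v'} →
    Unique (map proj₁ xs) → (k , v) ∈ xs → (k , v') ∈ xs → v ≡ v'
  Unique-keys⇒functional _        (here refl) (here refl) = refl
  Unique-keys⇒functional (k∉ ∷ _) (here refl) (there m)   = ⊥-elim (All.lookup k∉ (∈-map⁺ proj₁ m) refl)
  Unique-keys⇒functional (k∉ ∷ _) (there m)   (here refl) = ⊥-elim (All.lookup k∉ (∈-map⁺ proj₁ m) refl)
  Unique-keys⇒functional (_ ∷ u)  (there m)   (there m')  = Unique-keys⇒functional u m m'

module _ {B : ℕ} where

  labels : List (Field B) → List Label
  labels = map proj₁

  DistinctKind⇒Unique-labels : ∀ {Fl Fr : List (Field B)} →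
    DistinctKind Fl Fr → Unique (labels Fl ++ labels Fr)
  DistinctKind⇒Unique-labels {Fl} {Fr} = subst Unique (map-++ proj₁ Fl Fr)

  DistinctKind⇒Unique-left : ∀ {Fl Fr : List (Field B)} → DistinctKind Fl Fr → Unique (labels Fl)
  DistinctKind⇒Unique-left {Fl} {Fr} = Unique-++⁻ˡ (labels Fl) ∘ DistinctKind⇒Unique-labels {Fl} {Fr}

  DistinctKind⇒Unique-right : ∀ {Fl Fr : List (Field B)} → DistinctKind Fl Fr → Unique (labels Fr)
  DistinctKind⇒Unique-right {Fl} {Fr} = Unique-++⁻ʳ (labels Fl) ∘ DistinctKind⇒Unique-labels {Fl} {Fr}

  DistinctKind⇒Disjoint : ∀ {Fl Fr : List (Field B)} → DistinctKind Fl Fr → Disjoint Fl Fr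
  DistinctKind⇒Disjoint {Fl} {Fr} d (f∈Fl , f∈Fr) =
    Unique-++⇒Disjoint (labels Fl) (DistinctKind⇒Unique-labels {Fl} {Fr} d)
      (∈-map⁺ proj₁ f∈Fl , ∈-map⁺ proj₁ f∈Fr)

  removed-field-∉ : ∀ {F G : List (Field B)} {f} → Unique (labels F) → F ↭ f ∷ G → f ∉ G
  removed-field-∉ u p = Unique-↭-∷⇒∉ u (map⁺ proj₁ p) ∘ ∈-map⁺ proj₁

  opt-∈⁻ : ∀ {x f : Field B} b F → x ∈ opt b f F → x ≡ f ⊎ x ∈ F
  opt-∈⁻ true  F (here x≡f) = inj₁ x≡f
  opt-∈⁻ true  F (there x∈) = inj₂ x∈
  opt-∈⁻ false F x∈         = inj₂ x∈

  ∈ᶠ⇒label∈ : ∀ {f : Field B} fs → f ∈ᶠ fs → proj₁ f ∈ labelsᶠ fs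
  ∈ᶠ⇒label∈ (fcons _ _ _  _) (inj₁ refl) = here refl
  ∈ᶠ⇒label∈ (fcons _ _ fs _) (inj₂ f∈)   = there (∈ᶠ⇒label∈ fs f∈)

  ⊩-distinct : ∀ {K : KAssign B} {τ Fl Fr} → K ⊩ τ ∷ ⟦ Fl ∥ Fr ⟧ → DistinctKind Fl Fr
  ⊩-distinct (kRec d _ _ _ _) = d
  ⊩-distinct (kVar d _ _ _)   = d
  ⊩-distinct (kExt _ d _ _ _) = d
  ⊩-distinct (kCon _ d _ _ _) = d

  ⊩-present-absent-disjoint : ∀ {K : KAssign B} → WfKAssign K → ∀ {τ Fl Fr Gl Gr} →
    K ⊩ τ ∷ ⟦ Fl ∥ Fr ⟧ → K ⊩ τ ∷ ⟦ Gl ∥ Gr ⟧ → Disjoint Fl Gr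
  ⊩-present-absent-disjoint wf (kRec {fs = fs} _ Fl⊆fs _ _ _) (kRec _ _ fs∉Gr _ _) (x∈Fl , x∈Gr) =
    fs∉Gr (∈ᶠ⇒label∈ fs (Fl⊆fs x∈Fl)) (∈-map⁺ proj₁ x∈Gr)
  ⊩-present-absent-disjoint (keys , kinds) (kVar _ α∈K Fl⊆ _) (kVar _ α∈K' _ Gr⊆) (x∈Fl , x∈Gr)
    with Unique-keys⇒functional keys α∈K α∈K'
  ... | refl = DistinctKind⇒Disjoint (proj₁ (kinds α∈K)) (Fl⊆ x∈Fl , Gr⊆ x∈Gr)
  ⊩-present-absent-disjoint wf (kExt {Fl = Fl} b _ D Gl↭ _) (kExt _ _ D' _ Fr'↭) (x∈Gl , x∈Gr)
    with opt-∈⁻ b Fl (∈-resp-↭ Gl↭ x∈Gl)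
  ... | inj₂ x∈Fl = ⊩-present-absent-disjoint wf D D' (x∈Fl , ∈-resp-↭ (↭-sym Fr'↭) (there x∈Gr))
  ... | inj₁ refl = removed-field-∉ (DistinctKind⇒Unique-right (⊩-distinct D')) Fr'↭ x∈Gr
  ⊩-present-absent-disjoint wf (kCon _ _ D Fl↭ _) (kCon {Fr = Fr'} b' _ D' _ Gr'↭) (x∈Gl , x∈Gr)
    with opt-∈⁻ b' Fr' (∈-resp-↭ Gr'↭ x∈Gr)
  ... | inj₂ x∈Fr' = ⊩-present-absent-disjoint wf D D' (∈-resp-↭ (↭-sym Fl↭) (there x∈Gl) , x∈Fr')
  ... | inj₁ refl  = removed-field-∉ (DistinctKind⇒Unique-left (⊩-distinct D)) Fl↭ x∈Gl

mainTheorem3 : {B : ℕ} (K : KAssign B) → WfKAssign K →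
    (τ : Ty B) (l : Label) (τ' : Ty B) →
    ((Fl Fr Gl Gr : List (Field B)) →
       (l , τ') ∈ Fl → K ⊩ τ ∷ ⟦ Fl ∥ Fr ⟧ →
       (l , τ') ∈ Gr → ¬ (K ⊩ τ ∷ ⟦ Gl ∥ Gr ⟧))
    ×
    ((Fl Fr Gl Gr : List (Field B)) →
       (l , τ') ∈ Fr → K ⊩ τ ∷ ⟦ Fl ∥ Fr ⟧ →
       (l , τ') ∈ Gl → ¬ (K ⊩ τ ∷ ⟦ Gl ∥ Gr ⟧))
mainTheorem3 K wf τ l τ' =
  (λ _ _ _ _ f∈Fl D f∈Gr D' → ⊩-present-absent-disjoint wf D D' (f∈Fl , f∈Gr)) ,
  (λ _ _ _ _ f∈Fr D f∈Gl D' → ⊩-present-absent-disjoint wf D' D (f∈Gl , f∈Fr))
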